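{- Let $G=(V,E)$ be a finite simple graph and let $A\in\mathbb{R}^{E\times E}$ be the weighted adjacency matrix of the line graph of $G$ for some nonnegative weights, i.e. $A$ is symmetric with nonnegative entries and $A(e,f)=0$ unless $e\neq f$ share an endpoint. For $v\in V$ let $A^v\in\mathbb{R}^{E\times E}$ be defined by $A^v(e,f)=A(e,f)$ if both $e$ and $f$ are incident to $v$, and $A^v(e,f)=0$ otherwise. Then $$A^2\preceq2\sum_{v\in V}(A^v)^2.$$
   Context: $\preceq$ denotes the Loewner order on symmetric matrices. The line graph of $G$ has vertex set $E$, with two edges adjacent iff they share an endpoint. -}

module Defs where

open import Level using (Level; _⊔_) renaming (suc to lsuc)
open import Data.Nat using (ℕ; zero; suc)
open import Data.Fin using (Fin; zero; suc; _≟_)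
open import Data.Bool using (Bool; true; false; _∧_; _∨_; if_then_else_)
open import Data.Product using (_×_; ∃; Σ)
open import Data.Sum using (_⊎_)
open import Relation.Nullary using (¬_)
open import Relation.Nullary.Decidable using (⌊_⌋)
open import Relation.Binary.Core using (Rel)
open import Relation.Binary.Structures using (IsTotalOrder)
open import Relation.Binary.PropositionalEquality using (_≡_; _≢_)
open import Algebra.Bundles using (CommutativeRing)

-- Ordered fields (ℝ is one).  The stdlib has no reals and no fields,
-- so we state the result for an arbitrary ordered field.

record OrderedField (c ℓ₁ ℓ₂ : Level) : Set (lsuc (c ⊔ ℓ₁ ⊔ ℓ₂)) where
  field
    commutativeRing : CommutativeRing c ℓ₁
  open CommutativeRing commutativeRing public
  field
    _≤_          : Rel Carrier ℓ₂
    isTotalOrder : IsTotalOrder _≈_ _≤_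
    +-monoˡ-≤    : ∀ {x y} z → x ≤ y → (x + z) ≤ (y + z)
    *-nonneg     : ∀ {x y} → 0# ≤ x → 0# ≤ y → 0# ≤ (x * y)
    0≉1          : ¬ (0# ≈ 1#)
    inverse      : ∀ x → ¬ (x ≈ 0#) → ∃ λ y → (x * y) ≈ 1#

record SimpleGraph (n m : ℕ) : Set where
  field
    end₁ end₂ : Fin m → Fin n
    loopless  : ∀ e → end₁ e ≢ end₂ e
    noMulti   : ∀ e f →
                ((end₁ e ≡ end₁ f × end₂ e ≡ end₂ f) ⊎
                 (end₁ e ≡ end₂ f × end₂ e ≡ end₁ f)) → e ≡ f

module _ {n m : ℕ} (G : SimpleGraph n m) where
  open SimpleGraph G

  Incident : Fin n → Fin m → Set
  Incident v e = v ≡ end₁ e ⊎ v ≡ end₂ e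

  incident? : Fin n → Fin m → Bool
  incident? v e = ⌊ v ≟ end₁ e ⌋ ∨ ⌊ v ≟ end₂ e ⌋

  ShareEndpoint : Fin m → Fin m → Set
  ShareEndpoint e f = ∃ λ v → Incident v e × Incident v f

module _ {c ℓ₁ ℓ₂ : Level} (F : OrderedField c ℓ₁ ℓ₂) where
  open OrderedField F using (Carrier; _≈_; _+_; _*_; _-_; 0#; 1#; _≤_)

  Matrix : ℕ → Set c
  Matrix k = Fin k → Fin k → Carrier

  ∑ : ∀ k → (Fin k → Carrier) → Carrier
  ∑ zero    g = 0#
  ∑ (suc k) g = g zero + ∑ k (λ i → g (suc i))

  _⊕_ : ∀ {k} → Matrix k → Matrix k → Matrix k
  (M ⊕ N) i j = M i j + N i j

  _⊖_ : ∀ {k} → Matrix k → Matrix k → Matrix k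
  (M ⊖ N) i j = M i j - N i j

  _⊗_ : ∀ {k} → Matrix k → Matrix k → Matrix k
  _⊗_ {k} M N i j = ∑ k (λ l → M i l * N l j)

  scale : ∀ {k} → Carrier → Matrix k → Matrix k
  scale a M i j = a * M i j

  ∑M : ∀ {k} p → (Fin p → Matrix k) → Matrix k
  ∑M p Ms i j = ∑ p (λ v → Ms v i j)

  quad : ∀ {k} → Matrix k → (Fin k → Carrier) → Carrier
  quad {k} M x = ∑ k (λ i → ∑ k (λ j → x i * (M i j * x j)))

  PSD : ∀ {k} → Matrix k → Set (c ⊔ ℓ₂)
  PSD M = ∀ x → 0# ≤ quad M x

  _≼_ : ∀ {k} → Matrix k → Matrix k → Set (c ⊔ ℓ₂)
  M ≼ N = PSD (N ⊖ M)

  IsLineGraphWeighting : ∀ {n m} → SimpleGraph n m → Matrix m → Set (ℓ₁ ⊔ ℓ₂)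
  IsLineGraphWeighting G A =
      (∀ e f → A e f ≈ A f e)
    × (∀ e f → 0# ≤ A e f)
    × (∀ e f → (e ≡ f ⊎ ¬ ShareEndpoint G e f) → A e f ≈ 0#)

  restrictAt : ∀ {n m} → SimpleGraph n m → Matrix m → Fin n → Matrix m
  restrictAt G A v e f =
    if incident? G v e ∧ incident? G v f then A e f else 0#

-- Write u, w for the ends of an edge e and x for a test vector.  An entry
-- A e f can only be nonzero when f meets e at u or at w, and not at both
-- (that would force f = e), so (A x)_e = a_e + b_e with a_e = (A^u x)_e and
-- b_e = (A^w x)_e; moreover (A^v x)_e = 0 unless v ∈ {u, w}.  Hence, for
-- symmetric A and A^v,
--   xᵀ (2 ∑_v (A^v)²) x − xᵀ A² x = ∑_e (2 (a_e² + b_e²) − (a_e + b_e)²)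
--                                = ∑_e (a_e − b_e)²  ≥ 0.
module Submission where

open import Defs
open import Level using (Level)
open import Data.Nat using (ℕ)
open import Algebra.Bundles using (CommutativeRing)

open import Data.Bool using (true; false; _∨_)
open import Data.Bool.Properties using (∧-zeroʳ)
open import Data.Fin using (Fin; zero; suc; _≟_)
open import Data.Fin.Properties using (suc-injective)
open import Function using (_∘_)
open import Data.Product using (_,_; proj₁; proj₂)
open import Data.Sum using (_⊎_; inj₁; inj₂; [_,_])
open import Relation.Nullary using (¬_; Dec; yes; no; does; contradiction)
open import Relation.Nullary.Decidable using (_⊎-dec_; isYes≗does; dec-true; dec-false)
open import Relation.Binary.PropositionalEquality as ≡ using (_≡_; _≢_)

module _ {c ℓ} (R : CommutativeRing c ℓ) where
  open CommutativeRing R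
  open import Algebra.Properties.Ring ring using (-‿distribˡ-*; -‿distribʳ-*; -‿involutive)
  open import Algebra.Solver.Ring.NaturalCoefficients.Default commutativeSemiring
  open import Relation.Binary.Reasoning.Setoid setoid

  -x*-x≈x*x : ∀ x → - x * - x ≈ x * x
  -x*-x≈x*x x = begin
    - x * - x     ≈⟨ -‿distribˡ-* x (- x) ⟨
    - (x * - x)   ≈⟨ -‿cong (-‿distribʳ-* x x) ⟨
    - - (x * x)   ≈⟨ -‿involutive (x * x) ⟩
    x * x         ∎

  -- The solver only knows semirings, so - b enters as an atom d and the
  -- facts d * d ≈ b * b and b + d ≈ 0 are supplied by hand.
  [a+b]²+[a-b]²≈2[a²+b²] : ∀ a b →
    (a + b) * (a + b) + (a - b) * (a - b) ≈ (1# + 1#) * (a * a + b * b)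
  [a+b]²+[a-b]²≈2[a²+b²] a b = begin
    (a + b) * (a + b) + (a + - b) * (a + - b)
      ≈⟨ solve 3 (λ a b d → (a :+ b) :* (a :+ b) :+ (a :+ d) :* (a :+ d)
                   := con 2 :* (a :* a) :+ (b :* b :+ d :* d) :+ con 2 :* (a :* (b :+ d)))
               refl a b (- b) ⟩
    (1# + 1#) * (a * a) + (b * b + - b * - b) + (1# + 1#) * (a * (b + - b))
      ≈⟨ +-cong (+-congˡ (+-congˡ (-x*-x≈x*x b)))
                (trans (*-congˡ (trans (*-congˡ (-‿inverseʳ b)) (zeroʳ a))) (zeroʳ _)) ⟩
    (1# + 1#) * (a * a) + (b * b + b * b) + 0#
      ≈⟨ solve 2 (λ a b → con 2 :* (a :* a) :+ (b :* b :+ b :* b) :+ con 0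
                   := con 2 :* (a :* a :+ b :* b))
               refl a b ⟩
    (1# + 1#) * (a * a + b * b) ∎

module _ {n m : ℕ} (G : SimpleGraph n m) where
  open SimpleGraph G

  incident-dec : ∀ v e → Dec (Incident G v e)
  incident-dec v e = (v ≟ end₁ e) ⊎-dec (v ≟ end₂ e)

  incident?≡does : ∀ v e → incident? G v e ≡ does (incident-dec v e)
  incident?≡does v e = ≡.cong₂ _∨_ (isYes≗does (v ≟ end₁ e)) (isYes≗does (v ≟ end₂ e))

  incident?-true : ∀ {v e} → Incident G v e → incident? G v e ≡ true
  incident?-true {v} {e} ve = ≡.trans (incident?≡does v e) (dec-true (incident-dec v e) ve)

  incident?-false : ∀ {v e} → ¬ Incident G v e → incident? G v e ≡ false
  incident?-false {v} {e} ¬ve = ≡.trans (incident?≡does v e) (dec-false (incident-dec v e) ¬ve)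

  incident-to-both-ends⇒≡ : ∀ e f → Incident G (end₁ e) f → Incident G (end₂ e) f → e ≡ f
  incident-to-both-ends⇒≡ e f (inj₁ p) (inj₁ q) = contradiction (≡.trans p (≡.sym q)) (loopless e)
  incident-to-both-ends⇒≡ e f (inj₁ p) (inj₂ q) = noMulti e f (inj₁ (p , q))
  incident-to-both-ends⇒≡ e f (inj₂ p) (inj₁ q) = noMulti e f (inj₂ (p , q))
  incident-to-both-ends⇒≡ e f (inj₂ p) (inj₂ q) = contradiction (≡.trans p (≡.sym q)) (loopless e)

  incident-to-no-end⇒¬ShareEndpoint : ∀ e f →
    ¬ Incident G (end₁ e) f → ¬ Incident G (end₂ e) f → ¬ ShareEndpoint G e f
  incident-to-no-end⇒¬ShareEndpoint e f ¬p ¬q (v , inj₁ ≡.refl , i) = ¬p i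
  incident-to-no-end⇒¬ShareEndpoint e f ¬p ¬q (v , inj₂ ≡.refl , i) = ¬q i

module _ {c ℓ₁ ℓ₂ : Level} (F : OrderedField c ℓ₁ ℓ₂) where
  open OrderedField F hiding (zero)
  open import Algebra.Properties.Ring ring using (-1*x≈-x)
  open import Algebra.Properties.AbelianGroup +-abelianGroup using (xyx⁻¹≈y)
  open import Algebra.Properties.Semiring.Sum semiring as Sum using (sum)
  open import Relation.Binary.Structures using (IsTotalOrder)
  open IsTotalOrder isTotalOrder using (total; ≤-respʳ-≈) renaming (trans to ≤-trans; reflexive to ≤-reflexive)
  open import Relation.Binary.Reasoning.Setoid setoid

  -- ∑ F k and the library's sum agree only propositionally (both are stuck
  -- on a variable k); the lemmas below transport the library's algebra.

  ∑≡sum : ∀ k (f : Fin k → Carrier) → ∑ F k f ≡ sum f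
  ∑≡sum ℕ.zero    f = ≡.refl
  ∑≡sum (ℕ.suc k) f = ≡.cong (f zero +_) (∑≡sum k (λ i → f (suc i)))

  ∑-cong : ∀ k {f g : Fin k → Carrier} → (∀ i → f i ≈ g i) → ∑ F k f ≈ ∑ F k g
  ∑-cong k {f} {g} f≈g rewrite ∑≡sum k f | ∑≡sum k g = Sum.sum-cong-≋ f≈g

  ∑-distrib-+ : ∀ k (f g : Fin k → Carrier) → ∑ F k (λ i → f i + g i) ≈ ∑ F k f + ∑ F k g
  ∑-distrib-+ k f g rewrite ∑≡sum k (λ i → f i + g i) | ∑≡sum k f | ∑≡sum k g = Sum.∑-distrib-+ f g

  *-distribˡ-∑ : ∀ k a (f : Fin k → Carrier) → a * ∑ F k f ≈ ∑ F k (λ i → a * f i)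
  *-distribˡ-∑ k a f rewrite ∑≡sum k f | ∑≡sum k (λ i → a * f i) = Sum.*-distribˡ-sum a f

  *-distribʳ-∑ : ∀ k a (f : Fin k → Carrier) → ∑ F k f * a ≈ ∑ F k (λ i → f i * a)
  *-distribʳ-∑ k a f rewrite ∑≡sum k f | ∑≡sum k (λ i → f i * a) = Sum.*-distribʳ-sum a f

  ∑-zero : ∀ k {f : Fin k → Carrier} → (∀ i → f i ≈ 0#) → ∑ F k f ≈ 0#
  ∑-zero k {f} f≈0 rewrite ∑≡sum k f = trans (Sum.sum-cong-≋ f≈0) (Sum.sum-replicate-zero k)

  ∑-comm : ∀ k l (f : Fin k → Fin l → Carrier) →
           ∑ F k (λ i → ∑ F l (f i)) ≈ ∑ F l (λ j → ∑ F k (λ i → f i j))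
  ∑-comm ℕ.zero    l f = sym (∑-zero l (λ _ → refl))
  ∑-comm (ℕ.suc k) l f = begin
    ∑ F l (f zero) + ∑ F k (λ i → ∑ F l (f (suc i)))
      ≈⟨ +-congˡ (∑-comm k l (λ i → f (suc i))) ⟩
    ∑ F l (f zero) + ∑ F l (λ j → ∑ F k (λ i → f (suc i) j))
      ≈⟨ ∑-distrib-+ l (f zero) _ ⟨
    ∑ F l (λ j → f zero j + ∑ F k (λ i → f (suc i) j)) ∎

  ∑-distrib-- : ∀ k (f g : Fin k → Carrier) → ∑ F k (λ i → f i - g i) ≈ ∑ F k f - ∑ F k g
  ∑-distrib-- k f g = begin
    ∑ F k (λ i → f i - g i)            ≈⟨ ∑-distrib-+ k f (λ i → - g i) ⟩
    ∑ F k f + ∑ F k (λ i → - g i)      ≈⟨ +-congˡ (∑-cong k (λ i → -1*x≈-x (g i))) ⟨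
    ∑ F k f + ∑ F k (λ i → - 1# * g i) ≈⟨ +-congˡ (*-distribˡ-∑ k (- 1#) g) ⟨
    ∑ F k f + - 1# * ∑ F k g           ≈⟨ +-congˡ (-1*x≈-x _) ⟩
    ∑ F k f - ∑ F k g                  ∎

  ∑-supported-by-point : ∀ k (u : Fin k) (f : Fin k → Carrier) →
    (∀ v → v ≢ u → f v ≈ 0#) → ∑ F k f ≈ f u
  ∑-supported-by-point (ℕ.suc k) zero f off =
    trans (+-congˡ (∑-zero k (λ i → off (suc i) λ ()))) (+-identityʳ _)
  ∑-supported-by-point (ℕ.suc k) (suc u) f off =
    trans (+-cong (off zero λ ())
                  (∑-supported-by-point k u (λ i → f (suc i))
                     (λ i i≢u → off (suc i) (i≢u ∘ suc-injective))))
          (+-identityˡ _)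

  ∑-supported-by-pair : ∀ k (u w : Fin k) (f : Fin k → Carrier) → u ≢ w →
    (∀ v → v ≢ u → v ≢ w → f v ≈ 0#) → ∑ F k f ≈ f u + f w
  ∑-supported-by-pair (ℕ.suc k) zero    zero    f u≢w off = contradiction ≡.refl u≢w
  ∑-supported-by-pair (ℕ.suc k) zero    (suc w) f u≢w off =
    +-congˡ (∑-supported-by-point k w (λ i → f (suc i))
               (λ i i≢w → off (suc i) (λ ()) (i≢w ∘ suc-injective)))
  ∑-supported-by-pair (ℕ.suc k) (suc u) zero    f u≢w off =
    trans (+-congˡ (∑-supported-by-point k u (λ i → f (suc i))
                      (λ i i≢u → off (suc i) (i≢u ∘ suc-injective) (λ ()))))
          (+-comm _ _)
  ∑-supported-by-pair (ℕ.suc k) (suc u) (suc w) f u≢w off =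
    trans (+-cong (off zero (λ ()) (λ ()))
                  (∑-supported-by-pair k u w (λ i → f (suc i)) (u≢w ∘ ≡.cong suc)
                     (λ i i≢u i≢w → off (suc i) (i≢u ∘ suc-injective) (i≢w ∘ suc-injective))))
          (+-identityˡ _)

  +-nonneg : ∀ {a b} → 0# ≤ a → 0# ≤ b → 0# ≤ (a + b)
  +-nonneg {a} {b} 0≤a 0≤b =
    ≤-trans (≤-respʳ-≈ (sym (+-identityˡ b)) 0≤b) (+-monoˡ-≤ b 0≤a)

  ∑-nonneg : ∀ k {f : Fin k → Carrier} → (∀ i → 0# ≤ f i) → 0# ≤ (∑ F k f)
  ∑-nonneg ℕ.zero    0≤f = ≤-reflexive refl
  ∑-nonneg (ℕ.suc k) 0≤f = +-nonneg (0≤f zero) (∑-nonneg k (λ i → 0≤f (suc i)))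

  x*x-nonneg : ∀ x → 0# ≤ (x * x)
  x*x-nonneg x with total 0# x
  ... | inj₁ 0≤x = *-nonneg 0≤x 0≤x
  ... | inj₂ x≤0 = ≤-respʳ-≈ (-x*-x≈x*x commutativeRing x) (*-nonneg 0≤-x 0≤-x)
    where
    0≤-x : 0# ≤ (- x)
    0≤-x = ≤-trans (≤-reflexive (sym (-‿inverseʳ x)))
                   (≤-respʳ-≈ (+-identityˡ (- x)) (+-monoˡ-≤ (- x) x≤0))

  _*ᵥ_ : ∀ {k} → Matrix F k → (Fin k → Carrier) → Fin k → Carrier
  (M *ᵥ x) i = ∑ F _ (λ j → M i j * x j)

  _ᵥ*_ : ∀ {k} → (Fin k → Carrier) → Matrix F k → Fin k → Carrier
  (x ᵥ* M) j = ∑ F _ (λ i → x i * M i j)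

  ᵥ*-sym : ∀ {k} (M : Matrix F k) → (∀ i j → M i j ≈ M j i) → ∀ x j → (x ᵥ* M) j ≈ (M *ᵥ x) j
  ᵥ*-sym {k} M sym-M x j = ∑-cong k (λ i → trans (*-comm (x i) (M i j)) (*-congʳ (sym-M i j)))

  quad-⊖ : ∀ {k} (M N : Matrix F k) x → quad F (_⊖_ F M N) x ≈ quad F M x - quad F N x
  quad-⊖ {k} M N x = begin
    ∑ F k (λ i → ∑ F k (λ j → x i * ((M i j - N i j) * x j)))
      ≈⟨ ∑-cong k (λ i → ∑-cong k (λ j → trans (*-congˡ ([y-z]x≈yx-zx (x j) (M i j) (N i j)))
                                                (x[y-z]≈xy-xz (x i) _ _))) ⟩
    ∑ F k (λ i → ∑ F k (λ j → x i * (M i j * x j) - x i * (N i j * x j)))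
      ≈⟨ ∑-cong k (λ i → ∑-distrib-- k _ _) ⟩
    ∑ F k (λ i → ∑ F k (λ j → x i * (M i j * x j)) - ∑ F k (λ j → x i * (N i j * x j)))
      ≈⟨ ∑-distrib-- k _ _ ⟩
    quad F M x - quad F N x ∎
    where open import Algebra.Properties.Ring ring using (x[y-z]≈xy-xz; [y-z]x≈yx-zx)

  quad-scale : ∀ {k} a (M : Matrix F k) x → quad F (scale F a M) x ≈ a * quad F M x
  quad-scale {k} a M x = begin
    ∑ F k (λ i → ∑ F k (λ j → x i * (a * M i j * x j)))
      ≈⟨ ∑-cong k (λ i → ∑-cong k (λ j → x*[a*y*z]≈a*[x*[y*z]] (x i) (M i j) (x j))) ⟩
    ∑ F k (λ i → ∑ F k (λ j → a * (x i * (M i j * x j))))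
      ≈⟨ ∑-cong k (λ i → *-distribˡ-∑ k a _) ⟨
    ∑ F k (λ i → a * ∑ F k (λ j → x i * (M i j * x j)))
      ≈⟨ *-distribˡ-∑ k a _ ⟨
    a * quad F M x ∎
    where
    open import Algebra.Solver.CommutativeMonoid *-commutativeMonoid using (solve; _⊜_) renaming (_⊕_ to _·_)
    x*[a*y*z]≈a*[x*[y*z]] : ∀ u v w → u * (a * v * w) ≈ a * (u * (v * w))
    x*[a*y*z]≈a*[x*[y*z]] u v w =
      solve 4 (λ a u v w → (u · ((a · v) · w)) ⊜ (a · (u · (v · w)))) refl a u v w

  quad-∑M : ∀ {k} p (Ms : Fin p → Matrix F k) x →
            quad F (∑M F p Ms) x ≈ ∑ F p (λ v → quad F (Ms v) x)
  quad-∑M {k} p Ms x = begin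
    ∑ F k (λ i → ∑ F k (λ j → x i * (∑ F p (λ v → Ms v i j) * x j)))
      ≈⟨ ∑-cong k (λ i → ∑-cong k (λ j →
           trans (*-congˡ (*-distribʳ-∑ p (x j) _)) (*-distribˡ-∑ p (x i) _))) ⟩
    ∑ F k (λ i → ∑ F k (λ j → ∑ F p (λ v → x i * (Ms v i j * x j))))
      ≈⟨ ∑-cong k (λ i → ∑-comm k p _) ⟩
    ∑ F k (λ i → ∑ F p (λ v → ∑ F k (λ j → x i * (Ms v i j * x j))))
      ≈⟨ ∑-comm k p _ ⟩
    ∑ F p (λ v → quad F (Ms v) x) ∎

  quad-⊗ : ∀ {k} (M N : Matrix F k) x →
           quad F (_⊗_ F M N) x ≈ ∑ F k (λ l → (x ᵥ* M) l * (N *ᵥ x) l)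
  quad-⊗ {k} M N x = begin
    ∑ F k (λ i → ∑ F k (λ j → x i * (∑ F k (λ l → M i l * N l j) * x j)))
      ≈⟨ ∑-cong k (λ i → ∑-cong k (λ j →
           trans (*-congˡ (*-distribʳ-∑ k (x j) _))
           (trans (*-distribˡ-∑ k (x i) _)
                  (∑-cong k (λ l → reassoc (x i) (M i l) (N l j) (x j)))))) ⟩
    ∑ F k (λ i → ∑ F k (λ j → ∑ F k (λ l → (x i * M i l) * (N l j * x j))))
      ≈⟨ trans (∑-cong k (λ i → ∑-comm k k _)) (∑-comm k k _) ⟩
    ∑ F k (λ l → ∑ F k (λ i → ∑ F k (λ j → (x i * M i l) * (N l j * x j))))
      ≈⟨ ∑-cong k (λ l → trans (*-distribʳ-∑ k _ _) (∑-cong k (λ i → *-distribˡ-∑ k _ _))) ⟨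
    ∑ F k (λ l → (x ᵥ* M) l * (N *ᵥ x) l) ∎
    where
    reassoc : ∀ u v w z → u * (v * w * z) ≈ u * v * (w * z)
    reassoc u v w z = trans (*-congˡ (*-assoc v w z)) (sym (*-assoc u v (w * z)))

  quad-⊗-sym : ∀ {k} (M : Matrix F k) → (∀ i j → M i j ≈ M j i) → ∀ x →
               quad F (_⊗_ F M M) x ≈ ∑ F k (λ l → (M *ᵥ x) l * (M *ᵥ x) l)
  quad-⊗-sym {k} M sym-M x =
    trans (quad-⊗ M M x) (∑-cong k (λ l → *-congʳ (ᵥ*-sym M sym-M x l)))

  ≼-from-gap : ∀ {k} (M N : Matrix F k) (gap : (Fin k → Carrier) → Carrier) →
    (∀ x → quad F N x ≈ quad F M x + gap x) → (∀ x → 0# ≤ (gap x)) → _≼_ F M N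
  ≼-from-gap M N gap N≈M+gap 0≤gap x = ≤-respʳ-≈ (sym quad[N⊖M]≈gap) (0≤gap x)
    where
    quad[N⊖M]≈gap : quad F (_⊖_ F N M) x ≈ gap x
    quad[N⊖M]≈gap = begin
      quad F (_⊖_ F N M) x             ≈⟨ quad-⊖ N M x ⟩
      quad F N x - quad F M x          ≈⟨ +-congʳ (N≈M+gap x) ⟩
      quad F M x + gap x - quad F M x  ≈⟨ xyx⁻¹≈y (quad F M x) (gap x) ⟩
      gap x                            ∎

  module _ {n m : ℕ} (G : SimpleGraph n m) (A : Matrix F m) where
    open SimpleGraph G

    A[_] : Fin n → Matrix F m
    A[_] = restrictAt F G A

    A[v]-inside : ∀ {v e f} → Incident G v e → Incident G v f → A[ v ] e f ≡ A e f
    A[v]-inside ve vf rewrite incident?-true G ve | incident?-true G vf = ≡.refl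

    A[v]-outside : ∀ {v e f} → ¬ Incident G v e ⊎ ¬ Incident G v f → A[ v ] e f ≡ 0#
    A[v]-outside (inj₁ ¬ve) rewrite incident?-false G ¬ve = ≡.refl
    A[v]-outside {v} {e} (inj₂ ¬vf)
      rewrite incident?-false G ¬vf | ∧-zeroʳ (incident? G v e) = ≡.refl

    A[v]-sym : (∀ e f → A e f ≈ A f e) → ∀ v e f → A[ v ] e f ≈ A[ v ] f e
    A[v]-sym sym-A v e f with incident? G v e | incident? G v f
    ... | true  | true  = sym-A e f
    ... | true  | false = refl
    ... | false | true  = refl
    ... | false | false = refl

    at-end₁ at-end₂ : (Fin m → Carrier) → Fin m → Carrier
    at-end₁ x e = (A[ end₁ e ] *ᵥ x) e
    at-end₂ x e = (A[ end₂ e ] *ᵥ x) e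

    module _ (hA : IsLineGraphWeighting F G A) where
      private
        sym-A : ∀ e f → A e f ≈ A f e
        sym-A = proj₁ hA

        A-off : ∀ e f → e ≡ f ⊎ ¬ ShareEndpoint G e f → A e f ≈ 0#
        A-off = proj₂ (proj₂ hA)

      A≈A[end₁]+A[end₂] : ∀ e f → A e f ≈ A[ end₁ e ] e f + A[ end₂ e ] e f
      A≈A[end₁]+A[end₂] e f with incident-dec G (end₁ e) f | incident-dec G (end₂ e) f
      ... | yes p | yes q = begin
        A e f                  ≈⟨ A≈0 ⟩
        0#                     ≈⟨ +-identityʳ 0# ⟨
        0# + 0#                ≈⟨ +-cong (sym A≈0) (sym A≈0) ⟩
        A e f + A e f          ≡⟨ ≡.cong₂ _+_ (≡.sym (A[v]-inside (inj₁ ≡.refl) p))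
                                              (≡.sym (A[v]-inside (inj₂ ≡.refl) q)) ⟩
        A[ end₁ e ] e f + A[ end₂ e ] e f ∎
        where
        A≈0 : A e f ≈ 0#
        A≈0 = A-off e f (inj₁ (incident-to-both-ends⇒≡ G e f p q))
      ... | yes p | no ¬q = begin
        A e f                  ≈⟨ +-identityʳ (A e f) ⟨
        A e f + 0#             ≡⟨ ≡.cong₂ _+_ (≡.sym (A[v]-inside (inj₁ ≡.refl) p))
                                              (≡.sym (A[v]-outside (inj₂ ¬q))) ⟩
        A[ end₁ e ] e f + A[ end₂ e ] e f ∎
      ... | no ¬p | yes q = begin
        A e f                  ≈⟨ +-identityˡ (A e f) ⟨
        0# + A e f             ≡⟨ ≡.cong₂ _+_ (≡.sym (A[v]-outside (inj₂ ¬p)))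
                                              (≡.sym (A[v]-inside (inj₂ ≡.refl) q)) ⟩
        A[ end₁ e ] e f + A[ end₂ e ] e f ∎
      ... | no ¬p | no ¬q = begin
        A e f                  ≈⟨ A-off e f (inj₂ (incident-to-no-end⇒¬ShareEndpoint G e f ¬p ¬q)) ⟩
        0#                     ≈⟨ +-identityʳ 0# ⟨
        0# + 0#                ≡⟨ ≡.cong₂ _+_ (≡.sym (A[v]-outside (inj₂ ¬p)))
                                              (≡.sym (A[v]-outside (inj₂ ¬q))) ⟩
        A[ end₁ e ] e f + A[ end₂ e ] e f ∎

      A*ᵥ≈at-end₁+at-end₂ : ∀ x e → (A *ᵥ x) e ≈ at-end₁ x e + at-end₂ x e
      A*ᵥ≈at-end₁+at-end₂ x e =
        trans (∑-cong m (λ f → trans (*-congʳ (A≈A[end₁]+A[end₂] e f)) (distribʳ (x f) _ _)))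
              (∑-distrib-+ m _ _)

      A[v]*ᵥ-outside : ∀ x {v e} → ¬ Incident G v e → (A[ v ] *ᵥ x) e ≈ 0#
      A[v]*ᵥ-outside x ¬ve =
        ∑-zero m (λ f → trans (*-congʳ (reflexive (A[v]-outside (inj₁ ¬ve)))) (zeroˡ (x f)))

      ∑-[A[v]*ᵥ]² : ∀ x e →
        ∑ F n (λ v → (A[ v ] *ᵥ x) e * (A[ v ] *ᵥ x) e)
          ≈ at-end₁ x e * at-end₁ x e + at-end₂ x e * at-end₂ x e
      ∑-[A[v]*ᵥ]² x e = ∑-supported-by-pair n (end₁ e) (end₂ e) _ (loopless e) off-ends
        where
        off-ends : ∀ v → v ≢ end₁ e → v ≢ end₂ e → (A[ v ] *ᵥ x) e * (A[ v ] *ᵥ x) e ≈ 0#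
        off-ends v v≢u v≢w = trans (*-congʳ (A[v]*ᵥ-outside x [ v≢u , v≢w ])) (zeroˡ _)

      quad-2∑A[v]²≈quad-A²+gap : ∀ x →
        quad F (scale F (1# + 1#) (∑M F n (λ v → _⊗_ F A[ v ] A[ v ]))) x
          ≈ quad F (_⊗_ F A A) x + ∑ F m (λ e → (at-end₁ x e - at-end₂ x e) * (at-end₁ x e - at-end₂ x e))
      quad-2∑A[v]²≈quad-A²+gap x = begin
        quad F (scale F two (∑M F n (λ v → _⊗_ F A[ v ] A[ v ]))) x
          ≈⟨ trans (quad-scale two _ x) (*-congˡ (quad-∑M n _ x)) ⟩
        two * ∑ F n (λ v → quad F (_⊗_ F A[ v ] A[ v ]) x)
          ≈⟨ *-congˡ (∑-cong n (λ v → quad-⊗-sym A[ v ] (A[v]-sym sym-A v) x)) ⟩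
        two * ∑ F n (λ v → ∑ F m (λ e → (A[ v ] *ᵥ x) e * (A[ v ] *ᵥ x) e))
          ≈⟨ *-congˡ (trans (∑-comm n m _) (∑-cong m (∑-[A[v]*ᵥ]² x))) ⟩
        two * ∑ F m (λ e → a e * a e + b e * b e)
          ≈⟨ *-distribˡ-∑ m two _ ⟩
        ∑ F m (λ e → two * (a e * a e + b e * b e))
          ≈⟨ ∑-cong m (λ e → [a+b]²+[a-b]²≈2[a²+b²] commutativeRing (a e) (b e)) ⟨
        ∑ F m (λ e → (a e + b e) * (a e + b e) + (a e - b e) * (a e - b e))
          ≈⟨ ∑-distrib-+ m _ _ ⟩
        ∑ F m (λ e → (a e + b e) * (a e + b e)) + ∑ F m (λ e → (a e - b e) * (a e - b e))
          ≈⟨ +-congʳ (∑-cong m (λ e → *-cong (A*ᵥ≈at-end₁+at-end₂ x e)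
                                              (A*ᵥ≈at-end₁+at-end₂ x e))) ⟨
        ∑ F m (λ e → (A *ᵥ x) e * (A *ᵥ x) e) + ∑ F m (λ e → (a e - b e) * (a e - b e))
          ≈⟨ +-congʳ (quad-⊗-sym A sym-A x) ⟨
        quad F (_⊗_ F A A) x + ∑ F m (λ e → (a e - b e) * (a e - b e)) ∎
        where
        two : Carrier
        two = 1# + 1#
        a b : Fin m → Carrier
        a = at-end₁ x
        b = at-end₂ x

lemma5p8 : ∀ {c ℓ₁ ℓ₂ : Level} (F : OrderedField c ℓ₁ ℓ₂) {n m : ℕ}
             (G : SimpleGraph n m) (A : Matrix F m) →
             IsLineGraphWeighting F G A →
             _≼_ F (_⊗_ F A A)
               (scale F (OrderedField._+_ F (OrderedField.1# F) (OrderedField.1# F))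
                 (∑M F n (λ v → _⊗_ F (restrictAt F G A v) (restrictAt F G A v))))
lemma5p8 F {m = m} G A hA =
  ≼-from-gap F _ _ _ (quad-2∑A[v]²≈quad-A²+gap F G A hA)
    (λ x → ∑-nonneg F m (λ e → x*x-nonneg F _))
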